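{- If $\Gamma\vdash t:T$ holds in the Fitch-style idempotent S4 system and $(\Delta,\Delta')=S(\Gamma)$, then $\Delta;\Delta'\vdash t:T$ holds in the Kripke-style idempotent S4 system.
   Context: Types $T::=B\mid\square T\mid S\longrightarrow T$; terms $t::=x\mid\mathsf{box}\,t\mid\mathsf{unbox}\,t\mid\lambda x.t\mid s\ t$ (names, up to $\alpha$). Fitch-style contexts: $\Gamma::=\cdot\mid\Gamma,x:T\mid\Gamma,\text{lock}$; $\Gamma^{\text{lock}}$ denotes $\Gamma$ with all locks removed. Fitch-style idempotent S4 judgment $\Gamma\vdash t:T$: if $\Gamma=\Gamma_1,x:T,\Gamma_2$ where $\Gamma_2$ contains no lock, then $\Gamma\vdash x:T$; if $\Gamma,\text{lock}\vdash t:T$ then $\Gamma\vdash\mathsf{box}\,t:\square T$; if $\Gamma^{\text{lock}}\vdash t:\square T$ then $\Gamma\vdash\mathsf{unbox}\,t:T$; if $\Gamma,x:S\vdash t:T$ then $\Gamma\vdash\lambda x.t:S\longrightarrow T$; if $\Gamma\vdash t:S\longrightarrow T$ and $\Gamma\vdash s:S$ then $\Gamma\vdash t\ s:T$. Kripke-style idempotent S4 judgment $\Delta;\Delta'\vdash t:T$ (lock-free contexts $\Delta,\Delta'$): if $x:T\in\Delta'$ then $\Delta;\Delta'\vdash x:T$; if $(\Delta,\Delta');\cdot\vdash t:T$ then $\Delta;\Delta'\vdash\mathsf{box}\,t:\square T$; if $\cdot;(\Delta,\Delta')\vdash t:\square T$ then $\Delta;\Delta'\vdash\mathsf{unbox}\,t:T$;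 if $\Delta;(\Delta',x:S)\vdash t:T$ then $\Delta;\Delta'\vdash\lambda x.t:S\longrightarrow T$; if $\Delta;\Delta'\vdash t:S\longrightarrow T$ and $\Delta;\Delta'\vdash s:S$ then $\Delta;\Delta'\vdash t\ s:T$. The function $S$ from Fitch contexts to pairs of lock-free contexts: $S(\cdot)=(\cdot,\cdot)$; $S(\Gamma,x:T)=(\Delta,(\Delta',x:T))$ where $(\Delta,\Delta')=S(\Gamma)$; $S(\Gamma,\text{lock})=(\Gamma^{\text{lock}},\cdot)$. -}

module Defs where

open import Data.Nat using (ℕ)
open import Data.Product using (_×_; _,_)

Name : Set
Name = ℕ

data Ty : Set where
  B   : Ty
  □_  : Ty → Ty
  _⟶_ : Ty → Ty → Ty

infixr 7 _⟶_
infix 8 □_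
infix 4 _⊢F_∶_ _⨾_⊢K_∶_ _∶_∈ᶠ_ _∶_∈_

data Tm : Set where
  var   : Name → Tm
  box   : Tm → Tm
  unbox : Tm → Tm
  lam   : Name → Tm → Tm
  app   : Tm → Tm → Tm

data FCtx : Set where
  ·     : FCtx
  _,_∶_ : FCtx → Name → Ty → FCtx
  _,🔒   : FCtx → FCtx

data Ctx : Set where
  ∙     : Ctx
  _,_∶_ : Ctx → Name → Ty → Ctx

_++_ : Ctx → Ctx → Ctx
Δ ++ ∙ = Δ
Δ ++ (Δ' , x ∶ T) = (Δ ++ Δ') , x ∶ T

unlock : FCtx → Ctx
unlock · = ∙
unlock (Γ , x ∶ T) = unlock Γ , x ∶ T
unlock (Γ ,🔒) = unlock Γ

⌜_⌝ : Ctx → FCtx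
⌜ ∙ ⌝ = ·
⌜ Δ , x ∶ T ⌝ = ⌜ Δ ⌝ , x ∶ T

-- Γ₁ , x : T , Γ₂ with Γ₂ lock-free: x : T occurs in Γ with no lock to its right
data _∶_∈ᶠ_ : Name → Ty → FCtx → Set where
  here  : ∀ {Γ x T} → x ∶ T ∈ᶠ (Γ , x ∶ T)
  there : ∀ {Γ x T y S} → x ∶ T ∈ᶠ Γ → x ∶ T ∈ᶠ (Γ , y ∶ S)

data _∶_∈_ : Name → Ty → Ctx → Set where
  here  : ∀ {Δ x T} → x ∶ T ∈ (Δ , x ∶ T)
  there : ∀ {Δ x T y S} → x ∶ T ∈ Δ → x ∶ T ∈ (Δ , y ∶ S)

data _⊢F_∶_ : FCtx → Tm → Ty → Set where
  F-var   : ∀ {Γ x T} → x ∶ T ∈ᶠ Γ → Γ ⊢F var x ∶ T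
  F-box   : ∀ {Γ t T} → (Γ ,🔒) ⊢F t ∶ T → Γ ⊢F box t ∶ □ T
  F-unbox : ∀ {Γ t T} → ⌜ unlock Γ ⌝ ⊢F t ∶ □ T → Γ ⊢F unbox t ∶ T
  F-lam   : ∀ {Γ x t S T} → (Γ , x ∶ S) ⊢F t ∶ T → Γ ⊢F lam x t ∶ (S ⟶ T)
  F-app   : ∀ {Γ t s S T} → Γ ⊢F t ∶ (S ⟶ T) → Γ ⊢F s ∶ S → Γ ⊢F app t s ∶ T

data _⨾_⊢K_∶_ : Ctx → Ctx → Tm → Ty → Set where
  K-var   : ∀ {Δ Δ' x T} → x ∶ T ∈ Δ' → Δ ⨾ Δ' ⊢K var x ∶ T
  K-box   : ∀ {Δ Δ' t T} → (Δ ++ Δ') ⨾ ∙ ⊢K t ∶ T → Δ ⨾ Δ' ⊢K box t ∶ □ T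
  K-unbox : ∀ {Δ Δ' t T} → ∙ ⨾ (Δ ++ Δ') ⊢K t ∶ □ T → Δ ⨾ Δ' ⊢K unbox t ∶ T
  K-lam   : ∀ {Δ Δ' x t S T} → Δ ⨾ (Δ' , x ∶ S) ⊢K t ∶ T → Δ ⨾ Δ' ⊢K lam x t ∶ (S ⟶ T)
  K-app   : ∀ {Δ Δ' t s S T} → Δ ⨾ Δ' ⊢K t ∶ (S ⟶ T) → Δ ⨾ Δ' ⊢K s ∶ S → Δ ⨾ Δ' ⊢K app t s ∶ T

Sp : FCtx → Ctx × Ctx
Sp · = ∙ , ∙
Sp (Γ , x ∶ T) with Sp Γ
... | Δ , Δ' = Δ , (Δ' , x ∶ T)
Sp (Γ ,🔒) = unlock Γ , ∙

{-# OPTIONS --safe #-}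
module Submission where

-- The split S(Γ) = (Δ, Δ') always satisfies
-- Δ ++ Δ' = Γ^lock, and Δ' is the segment of Γ after its last lock, which holds
-- exactly the variables the Fitch variable rule may use. The box and unbox
-- premises are then translated at S(Γ, lock) = (Γ^lock, ·) and S(Γ^lock) = (·, Γ^lock).

open import Defs
open import Data.Product using (_,_)
open import Relation.Binary.PropositionalEquality using (_≡_; refl; sym; subst)

Sp-extend : ∀ {Γ Δ Δ' x S} → Sp Γ ≡ (Δ , Δ') → Sp (Γ , x ∶ S) ≡ (Δ , (Δ' , x ∶ S))
Sp-extend {Γ} eq with Sp Γ
Sp-extend refl | _ = refl

Sp-⌜⌝ : ∀ Δ → Sp ⌜ Δ ⌝ ≡ (∙ , Δ)
Sp-⌜⌝ ∙           = refl
Sp-⌜⌝ (Δ , x ∶ T) = Sp-extend (Sp-⌜⌝ Δ)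

Sp-++ : ∀ Γ {Δ Δ'} → Sp Γ ≡ (Δ , Δ') → Δ ++ Δ' ≡ unlock Γ
Sp-++ ·           refl = refl
Sp-++ (Γ , x ∶ T) eq   with Sp Γ in eqΓ
Sp-++ (Γ , x ∶ T) refl | _ rewrite Sp-++ Γ eqΓ = refl
Sp-++ (Γ ,🔒)      refl = refl

∈ᶠ⇒∈-Sp : ∀ {Γ x T Δ Δ'} → x ∶ T ∈ᶠ Γ → Sp Γ ≡ (Δ , Δ') → x ∶ T ∈ Δ'
∈ᶠ⇒∈-Sp {Γ , _ ∶ _} here      eq   with Sp Γ
∈ᶠ⇒∈-Sp             here      refl | _ = here
∈ᶠ⇒∈-Sp {Γ , _ ∶ _} (there m) eq   with Sp Γ in eqΓ
∈ᶠ⇒∈-Sp             (there m) refl | _ = there (∈ᶠ⇒∈-Sp m eqΓ)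

lemma4p2 : ∀ {Γ t T Δ Δ'} → Γ ⊢F t ∶ T → Sp Γ ≡ (Δ , Δ') → Δ ⨾ Δ' ⊢K t ∶ T
lemma4p2 (F-var m) eq = K-var (∈ᶠ⇒∈-Sp m eq)
lemma4p2 {Γ} (F-box d) eq =
  K-box (subst (λ Θ → Θ ⨾ ∙ ⊢K _ ∶ _) (sym (Sp-++ Γ eq)) (lemma4p2 d refl))
lemma4p2 {Γ} (F-unbox d) eq =
  K-unbox (subst (λ Θ → ∙ ⨾ Θ ⊢K _ ∶ _) (sym (Sp-++ Γ eq)) (lemma4p2 d (Sp-⌜⌝ (unlock Γ))))
lemma4p2 (F-lam d) eq = K-lam (lemma4p2 d (Sp-extend eq))
lemma4p2 (F-app d e) eq = K-app (lemma4p2 d eq) (lemma4p2 e eq)
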